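{- Let $H$ be a connected graph with at least three nodes and let $r_H = \widetilde{\operatorname{diam}}(H) - 1$. For every integer $T < r_H$, there exists no $T$-round algorithm for $\textsc{MemList}(H)$ or for $\textsc{MemDetect}(H)$ under node insertions.
   Context: For nodes $u,v$ of a graph $G$, $\operatorname{dist}_G(u,v)$ is the shortest-path distance. The node-edge distance between a node $u$ and an edge $e=\{v,w\}$ is $\operatorname{dist}_G(u,e) = 1 + \min\{\operatorname{dist}_G(u,v), \operatorname{dist}_G(u,w)\}$, and $\widetilde{\operatorname{diam}}(G) = \max_{u \in V(G)} \max_{e \in E(G)} \operatorname{dist}_G(u,e)$. Dynamic network model: a sequence of graphs $G^0, G^1, \ldots$, each obtained from the previous by at most one node insertion (a new node adjacent to an arbitrary subset of existing nodes); nodes have distinct IDs, know their neighbors' IDs and initially the whole of $G^0$; communication is synchronous, each round the change happens first and then each node sends a message to each neighbor (bandwidth arbitrary); nodes detect changes only through their neighbor lists. A $T$-round algorithm works under the promise that each change at round $i$ is followed by $T-1$ change-free rounds and must output correctly for $G^i$ by the end of round $i+T-1$. $\textsc{MemList}(H)$: each node $v$ lists all subgraphs isomorphic to $H$ containing $v$. $\textsc{MemDetect}(H)$: each node $v$ outputs whether it belongs to some subgraph isomorphic to $H$. -}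

module Defs where

open import Data.Nat using (ℕ; zero; suc; _+_; _≤_; _<_; _⊓_; _≡ᵇ_)
open import Data.Bool using (Bool; true; false; _∧_; _∨_; if_then_else_)
open import Data.Fin using (Fin)
open import Data.List using (List; []; _∷_; map; filterᵇ)
open import Data.Bool.ListAction using (any)
open import Data.List.Membership.Propositional using (_∈_; _∉_)
open import Data.List.Relation.Unary.All using (All)
open import Data.List.Relation.Unary.Unique.Propositional using (Unique)
open import Data.Maybe using (Maybe; just; nothing)
open import Data.Product using (Σ; ∃; _×_; _,_)
open import Relation.Binary.PropositionalEquality using (_≡_)
open import Function.Bundles using (_⇔_)

record SimpleGraph (k : ℕ) : Set where
  field
    adj    : Fin k → Fin k → Bool
    sym    : ∀ a b → adj a b ≡ adj b a
    irrefl : ∀ a → adj a a ≡ false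
open SimpleGraph public

data Walk {k : ℕ} (H : SimpleGraph k) : Fin k → Fin k → ℕ → Set where
  here : ∀ {a} → Walk H a a 0
  step : ∀ {a b c n} → adj H a c ≡ true → Walk H c b n → Walk H a b (suc n)

Connected : ∀ {k} → SimpleGraph k → Set
Connected H = ∀ a b → ∃ λ n → Walk H a b n

Dist : ∀ {k} → SimpleGraph k → Fin k → Fin k → ℕ → Set
Dist H a b d = Walk H a b d × (∀ m → Walk H a b m → d ≤ m)

NodeEdgeDist : ∀ {k} → SimpleGraph k → Fin k → Fin k → Fin k → ℕ → Set
NodeEdgeDist H u v w d =
  ∃ λ dv → ∃ λ dw → Dist H u v dv × Dist H u w dw × d ≡ suc (dv ⊓ dw)

IsDiamTilde : ∀ {k} → SimpleGraph k → ℕ → Set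
IsDiamTilde {k} H D =
  (Σ (Fin k) λ u → Σ (Fin k) λ v → Σ (Fin k) λ w →
     adj H v w ≡ true × NodeEdgeDist H u v w D)
  × (∀ u v w d → adj H v w ≡ true → NodeEdgeDist H u v w d → d ≤ D)

record Graph : Set where
  field
    V   : List ℕ
    nadj : ℕ → ℕ → Bool
open Graph public

WellFormed : Graph → Set
WellFormed G =
  Unique (V G)
  × (∀ u w → nadj G u w ≡ true → u ∈ V G × w ∈ V G)
  × (∀ u w → nadj G u w ≡ nadj G w u)
  × (∀ u → nadj G u u ≡ false)

_∈ᵇ_ : ℕ → List ℕ → Bool
x ∈ᵇ xs = any (λ y → x ≡ᵇ y) xs

-- A node insertion: the new node's ID and the list of existing nodes it is adjacent to.
Insertion : Set
Insertion = ℕ × List ℕ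

insertNode : Insertion → Graph → Graph
insertNode (x , S) G = record
  { V    = x ∷ V G
  ; nadj = λ u w → nadj G u w ∨ ((u ≡ᵇ x) ∧ (w ∈ᵇ S)) ∨ ((w ≡ᵇ x) ∧ (u ∈ᵇ S)) }

applyEvent : Maybe Insertion → Graph → Graph
applyEvent nothing    G = G
applyEvent (just ins) G = insertNode ins G

-- ev i is the (optional) change happening at the start of round suc i.
Events : Set
Events = ℕ → Maybe Insertion

graphAt : Graph → Events → ℕ → Graph
graphAt G0 ev zero    = G0
graphAt G0 ev (suc i) = applyEvent (ev i) (graphAt G0 ev i)

ValidEvents : Graph → Events → Set
ValidEvents G0 ev = ∀ i x S → ev i ≡ just (x , S) →
  x ∉ V (graphAt G0 ev i) × All (λ u → u ∈ V (graphAt G0 ev i)) S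

Promise : ℕ → Events → Set
Promise T ev = ∀ i ins → ev i ≡ just ins → ∀ j → i < j → j < i + T → ev j ≡ nothing

neighbours : Graph → ℕ → List ℕ
neighbours G v = filterᵇ (λ u → nadj G v u) (V G)

-- Deterministic synchronous algorithms with unbounded messages.

record Algorithm (Out : Set) : Set₁ where
  field
    State   : Set
    Msg     : Set
    init    : Graph → ℕ → State          -- nodes of G^0 know G^0 and their ID
    initNew : ℕ → State                  -- an inserted node knows its ID
    send    : State → List ℕ → ℕ → Msg   -- state, current neighbour list, recipient
    recv    : State → List ℕ → List (ℕ × Msg) → State
    output  : State → Out

-- state of node v at the end of round i
state : ∀ {Out} (A : Algorithm Out) → Graph → Events → ℕ → ℕ → Algorithm.State A
state A G0 ev zero v = Algorithm.init A G0 v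
state A G0 ev (suc i) v =
  Algorithm.recv A (prev v) (N v)
    (map (λ u → u , Algorithm.send A (prev u) (N u) v) (N v))
  where
    N : ℕ → List ℕ
    N = neighbours (graphAt G0 ev (suc i))
    prev : ℕ → Algorithm.State A
    prev u = if u ∈ᵇ V (graphAt G0 ev i) then state A G0 ev i u else Algorithm.initNew A u

record Problem : Set₁ where
  field
    Out     : Set
    Correct : Graph → ℕ → Out → Set
open Problem public

Solves : ℕ → (P : Problem) → Algorithm (Out P) → Set
Solves T P A = ∀ G0 → WellFormed G0 → ∀ ev → ValidEvents G0 ev → Promise T ev →
  ∀ i ins → ev i ≡ just ins →
  ∀ v → v ∈ V (graphAt G0 ev (suc i)) →
  Correct P (graphAt G0 ev (suc i)) v (Algorithm.output A (state A G0 ev (i + T) v))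

-- Subgraphs of G isomorphic to H, given as copies (injective homomorphisms) of H.

IsCopy : ∀ {k} → SimpleGraph k → Graph → (Fin k → ℕ) → Set
IsCopy H G f =
  (∀ a b → f a ≡ f b → a ≡ b)
  × (∀ a → f a ∈ V G)
  × (∀ a b → adj H a b ≡ true → nadj G (f a) (f b) ≡ true)

Contains : ∀ {k} → (Fin k → ℕ) → ℕ → Set
Contains f v = ∃ λ a → f a ≡ v

EdgeImg : ∀ {k} → SimpleGraph k → (Fin k → ℕ) → ℕ → ℕ → Set
EdgeImg H f u w = ∃ λ a → ∃ λ b → adj H a b ≡ true × f a ≡ u × f b ≡ w

SameSubgraph : ∀ {k} → SimpleGraph k → (Fin k → ℕ) → (Fin k → ℕ) → Set
SameSubgraph H f g =
  (∀ u → Contains f u ⇔ Contains g u)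
  × (∀ u w → EdgeImg H f u w ⇔ EdgeImg H g u w)

MemList : ∀ {k} → SimpleGraph k → Problem
MemList {k} H = record
  { Out = List (Fin k → ℕ)
  ; Correct = λ G v L →
      (∀ f → f ∈ L → IsCopy H G f × Contains f v)
      × (∀ g → IsCopy H G g → Contains g v → ∃ λ f → f ∈ L × SameSubgraph H f g) }

MemDetect : ∀ {k} → SimpleGraph k → Problem
MemDetect {k} H = record
  { Out = Bool
  ; Correct = λ G v b → (b ≡ true) ⇔ (∃ λ g → IsCopy H G g × Contains g v) }

module Submission where

-- Take a node u and an edge {v,w} of H realising diam~(H), so that dist(u,v) and dist(u,w)
-- exceed T. Start from H with w deleted and insert w once, either with all of its H-neighbours
-- (the result is H, and u lies on a copy of H) or with all of them but v (the result has one
-- edge fewer than H, hence no copy of H at all). The two runs differ only around v and w, and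
-- information travels one hop per round, so after T rounds u is in the same state in both runs
-- and gives the same output, although MemList and MemDetect demand different answers.

open import Defs
open import Data.Fin using (Fin; toℕ)
open import Data.Fin.Properties using (toℕ-injective)
import Data.Fin.Properties as Fin
import Data.Bool as Bool
open import Data.Bool using (Bool; true; false; T; T?; _∧_; _∨_; if_then_else_)
open import Data.Bool.Properties using (T-≡; T-∨; T-∧; ¬-not; ⇔→≡)
open import Data.Nat using (ℕ; zero; suc; _≤_; _<_; _∸_; _⊓_; _≡ᵇ_; z≤n; s≤s; s<s⁻¹)
import Data.Nat.Properties as ℕ
open import Data.Nat.Properties using (≡ᵇ⇒≡; ≡⇒≡ᵇ; ≤-trans; <-trans; module ≤-Reasoning; <-≤-trans; n<1+n)
open import Data.List using (List; []; _∷_; length; filter; filterᵇ; map; allFin; cartesianProduct)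
open import Data.List.Properties using (filter-notAll; map-cong-local; length-map)
open import Data.List.Relation.Unary.Any as Any using (here; there)
open import Data.List.Relation.Unary.Any.Properties using (any⁺; any⁻)
import Data.List.Relation.Unary.All as All
open import Data.List.Relation.Unary.AllPairs using (_∷_)
open import Data.List.Relation.Unary.Unique.Propositional using (Unique)
import Data.List.Relation.Unary.Unique.Propositional.Properties as Unique
open import Data.List.Membership.Propositional using (_∈_; _∉_)
open import Data.List.Membership.Propositional.Properties using (∈-filter⁺; ∈-filter⁻; ∈-map⁺; ∈-map⁻; ∈-allFin; ∈-cartesianProduct⁺)
open import Data.List.Relation.Binary.Subset.Propositional using (_⊆_)
open import Data.List.Relation.Binary.Subset.Propositional.Properties using (⊆-refl)
open import Data.Maybe using (just; nothing)
open import Data.Unit using (⊤; tt)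
open import Data.Product using (Σ; ∃; ∃₂; _×_; _,_; proj₁; proj₂)
open import Data.Product.Properties using (,-injective; ≡-dec)
open import Data.Sum using (_⊎_; inj₁; inj₂)
open import Data.Sum.Function.Propositional using (_⊎-⇔_)
open import Data.Product.Function.NonDependent.Propositional using (_×-⇔_)
open import Function using (_∘_)
open import Function.Bundles using (_⇔_; mk⇔; Equivalence)
import Function.Properties.Equivalence as ⇔
open import Relation.Binary.Definitions using (DecidableEquality)
open import Relation.Unary using (Decidable)
open import Relation.Nullary using (¬_; contradiction; ¬?; Dec; yes; no; does; _×-dec_)
open import Relation.Nullary.Decidable using (does-⇔; dec-true; dec-false)
open import Relation.Binary.PropositionalEquality as ≡ using (_≡_; _≢_; _≗_; refl; cong; cong₂)

open Equivalence using (to; from)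

∈ᵇ⇔∈ : ∀ {x xs} → (x ∈ᵇ xs) ≡ true ⇔ x ∈ xs
∈ᵇ⇔∈ {x} {xs} = mk⇔
  (λ e → Any.map (≡ᵇ⇒≡ x _) (any⁻ (x ≡ᵇ_) xs (from T-≡ e)))
  (λ x∈xs → to T-≡ (any⁺ (x ≡ᵇ_) (Any.map (≡⇒≡ᵇ x _) x∈xs)))

≢⇒≡ᵇ-false : ∀ {m n} → m ≢ n → (m ≡ᵇ n) ≡ false
≢⇒≡ᵇ-false {m} {n} m≢n = ¬-not (m≢n ∘ ≡ᵇ⇒≡ m n ∘ from T-≡)

insertNode-adj⇔ : ∀ {G x S u z} → nadj (insertNode (x , S) G) u z ≡ true ⇔
  (nadj G u z ≡ true ⊎ (u ≡ x × z ∈ S) ⊎ (z ≡ x × u ∈ S))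
insertNode-adj⇔ {x = x} {S} =
  ⇔.trans (⇔.sym T-≡) (⇔.trans T-∨ (T-≡ ⊎-⇔ ⇔.trans T-∨ (new-edge ⊎-⇔ new-edge)))
  where
    new-edge : ∀ {a b} → T ((a ≡ᵇ x) ∧ (b ∈ᵇ S)) ⇔ (a ≡ x × b ∈ S)
    new-edge {a} = ⇔.trans T-∧ (mk⇔ (≡ᵇ⇒≡ a x) (≡⇒≡ᵇ a x) ×-⇔ ⇔.trans T-≡ ∈ᵇ⇔∈)

insertNode-adj-cong : ∀ {G x S₁ S₂ u} → u ≢ x → (u ∈ S₁ ⇔ u ∈ S₂) →
  ∀ z → nadj (insertNode (x , S₁) G) u z ≡ nadj (insertNode (x , S₂) G) u z
insertNode-adj-cong {G} {x} {S₁} {S₂} {u} u≢x u∈S₁⇔u∈S₂ z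
  rewrite ≢⇒≡ᵇ-false u≢x =
    cong (λ b → nadj G u z ∨ ((z ≡ᵇ x) ∧ b))
         (⇔→≡ (⇔.trans ∈ᵇ⇔∈ (⇔.trans u∈S₁⇔u∈S₂ (⇔.sym ∈ᵇ⇔∈))))

unique-⊆⇒length≤ : ∀ {A : Set} → DecidableEquality A → {xs ys : List A} →
  Unique xs → xs ⊆ ys → length xs ≤ length ys
unique-⊆⇒length≤ _≟_ {[]} _ _ = z≤n
unique-⊆⇒length≤ _≟_ {x ∷ xs} {ys} (x∉xs ∷ xs!) xs⊆ys =
  ≤-trans (s≤s (unique-⊆⇒length≤ _≟_ xs! xs⊆ys-x))
          (filter-notAll (¬? ∘ (_≟ x)) ys (Any.map (λ x≡z z≢x → z≢x (≡.sym x≡z)) (xs⊆ys (here refl))))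
  where
    xs⊆ys-x : xs ⊆ filter (¬? ∘ (_≟ x)) ys
    xs⊆ys-x z∈xs = ∈-filter⁺ (¬? ∘ (_≟ x)) (xs⊆ys (there z∈xs)) (All.lookup x∉xs z∈xs ∘ ≡.sym)

filterᵇ-cong : ∀ {A : Set} {p q : A → Bool} → p ≗ q → filterᵇ p ≗ filterᵇ q
filterᵇ-cong p≗q [] = refl
filterᵇ-cong {p = p} {q} p≗q (x ∷ xs) with p x | q x | p≗q x
... | true  | .true  | refl = cong (x ∷_) (filterᵇ-cong p≗q xs)
... | false | .false | refl = filterᵇ-cong p≗q xs

∈-neighbours⁻ : ∀ {G y z} → z ∈ neighbours G y → nadj G y z ≡ true
∈-neighbours⁻ {G} {y} z∈N = to T-≡ (proj₂ (∈-filter⁻ (T? ∘ nadj G y) {xs = V G} z∈N))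

does⇒ : ∀ {P : Set} (P? : Dec P) → does P? ≡ true → P
does⇒ (yes p) _ = p

-- Locality of synchronous algorithms

insertOnce : ℕ → List ℕ → Events
insertOnce x S zero    = just (x , S)
insertOnce x S (suc _) = nothing

module _ (G0 : Graph) (x : ℕ) where

  graphAt-insertOnce : ∀ S t → graphAt G0 (insertOnce x S) (suc t) ≡ insertNode (x , S) G0
  graphAt-insertOnce S zero    = refl
  graphAt-insertOnce S (suc t) = graphAt-insertOnce S t

  insertOnce-valid : ∀ {S} → x ∉ V G0 → S ⊆ V G0 → ValidEvents G0 (insertOnce x S)
  insertOnce-valid x∉G0 S⊆G0 zero _ _ refl = x∉G0 , All.tabulate S⊆G0

  insertOnce-promise : ∀ T S → Promise T (insertOnce x S)
  insertOnce-promise T S i ins e (suc j) _ _ = refl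

SameNeighbours : Graph → Graph → ℕ → Set
SameNeighbours G₁ G₂ y = nadj G₁ y ≗ nadj G₂ y

-- Messages carry the sender's neighbour list, so the view of y also covers its neighbours' edges.
SameView : Graph → Graph → ℕ → ℕ → Set
SameView G₁ G₂ zero    y = ⊤
SameView G₁ G₂ (suc t) y =
  SameView G₁ G₂ t y × SameNeighbours G₁ G₂ y ×
  (∀ z → nadj G₁ y z ≡ true → SameView G₁ G₂ t z × SameNeighbours G₁ G₂ z)

module _ {Out : Set} (A : Algorithm Out) (G0 : Graph) (x : ℕ) (S₁ S₂ : List ℕ) where

  open Algorithm A

  private
    ev₁ = insertOnce x S₁
    ev₂ = insertOnce x S₂
    G₁ = insertNode (x , S₁) G0
    G₂ = insertNode (x , S₂) G0

    V-graphAt : ∀ t → V (graphAt G0 ev₁ t) ≡ V (graphAt G0 ev₂ t)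
    V-graphAt zero    = refl
    V-graphAt (suc t) rewrite graphAt-insertOnce G0 x S₁ t | graphAt-insertOnce G0 x S₂ t = refl

    neighbours-graphAt : ∀ t {y} → SameNeighbours G₁ G₂ y →
      neighbours (graphAt G0 ev₁ (suc t)) y ≡ neighbours (graphAt G0 ev₂ (suc t)) y
    neighbours-graphAt t same
      rewrite graphAt-insertOnce G0 x S₁ t | graphAt-insertOnce G0 x S₂ t = filterᵇ-cong same (x ∷ V G0)

    recv-cong : ∀ {s₁ s₂ N₁ N₂ ms₁ ms₂} → s₁ ≡ s₂ → N₁ ≡ N₂ → ms₁ ≡ ms₂ → recv s₁ N₁ ms₁ ≡ recv s₂ N₂ ms₂
    recv-cong refl refl refl = refl

  state-local : ∀ t y → SameView G₁ G₂ t y → state A G0 ev₁ t y ≡ state A G0 ev₂ t y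
  state-local zero    y _ = refl
  state-local (suc t) y (view-y , same-y , view-nbrs) =
    recv-cong (prev-≡ view-y) (neighbours-graphAt t same-y)
      (≡.trans (map-cong-local (All.tabulate message-≡)) (cong (map _) (neighbours-graphAt t same-y)))
    where
      prev : ∀ (ev : Events) → ℕ → State
      prev ev u = if u ∈ᵇ V (graphAt G0 ev t) then state A G0 ev t u else initNew u

      prev-≡ : ∀ {u} → SameView G₁ G₂ t u → prev ev₁ u ≡ prev ev₂ u
      prev-≡ {u} view-u = cong₂ (λ b s → if b then s else initNew u)
        (cong (u ∈ᵇ_) (V-graphAt t)) (state-local t u view-u)

      message-≡ : ∀ {z} → z ∈ neighbours (graphAt G0 ev₁ (suc t)) y →
        (z , send (prev ev₁ z) (neighbours (graphAt G0 ev₁ (suc t)) z) y)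
          ≡ (z , send (prev ev₂ z) (neighbours (graphAt G0 ev₂ (suc t)) z) y)
      message-≡ {z} z∈N
        with view-nbrs z (≡.subst (λ G → nadj G y z ≡ true) (graphAt-insertOnce G0 x S₁ t)
                            (∈-neighbours⁻ {graphAt G0 ev₁ (suc t)} z∈N))
      ... | view-z , same-z = cong₂ (λ s N → _ , send s N y) (prev-≡ view-z) (neighbours-graphAt t same-z)

-- Distances and edge counts in H

module _ {k} (H : SimpleGraph k) where

  adj⇒≢ : ∀ {a b} → adj H a b ≡ true → a ≢ b
  adj⇒≢ {a} ab refl with () ← ≡.trans (≡.sym (irrefl H a)) ab

  DistGreater : ℕ → Fin k → Fin k → Set
  DistGreater t a b = ∀ m → Walk H a b m → t < m

  DistGreater-pred : ∀ {t a b} → DistGreater (suc t) a b → DistGreater t a b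
  DistGreater-pred far m walk = <-trans (n<1+n _) (far m walk)

  DistGreater-step : ∀ {t a b c} → DistGreater (suc t) a b → adj H a c ≡ true → DistGreater t c b
  DistGreater-step far ac m walk = s<s⁻¹ (far (suc m) (step ac walk))

  DistGreater⇒≢ : ∀ {t a b} → DistGreater t a b → a ≢ b
  DistGreater⇒≢ far refl with () ← far 0 here

  Dist⇒DistGreater : ∀ {t a b d} → Dist H a b d → t < d → DistGreater t a b
  Dist⇒DistGreater (_ , shortest) t<d m walk = <-≤-trans t<d (shortest m walk)

  IsEdge : Fin k × Fin k → Set
  IsEdge (a , b) = adj H a b ≡ true

  isEdge? : Decidable IsEdge
  isEdge? (a , b) = adj H a b Bool.≟ true

  edges : List (Fin k × Fin k)
  edges = filter isEdge? (cartesianProduct (allFin k) (allFin k))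

  edges-unique : Unique edges
  edges-unique = Unique.filter⁺ isEdge? (Unique.cartesianProduct⁺ (Unique.allFin⁺ k) (Unique.allFin⁺ k))

  ∈-edges⁺ : ∀ {a b} → adj H a b ≡ true → (a , b) ∈ edges
  ∈-edges⁺ ab = ∈-filter⁺ isEdge? (∈-cartesianProduct⁺ (∈-allFin _) (∈-allFin _)) ab

  ∈-edges⁻ : ∀ {a b} → (a , b) ∈ edges → adj H a b ≡ true
  ∈-edges⁻ ab∈edges = proj₂ (∈-filter⁻ isEdge? {xs = cartesianProduct (allFin k) (allFin k)} ab∈edges)

  copy⇒edges≤ : ∀ {G g} {L : List (ℕ × ℕ)} → IsCopy H G g →
    (∀ {x y} → nadj G x y ≡ true → (x , y) ∈ L) → length edges ≤ length L
  copy⇒edges≤ {g = g} {L} (g-inj , _ , g-adj) G⊆L = begin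
    length edges            ≡⟨ length-map g² edges ⟨
    length (map g² edges)   ≤⟨ unique-⊆⇒length≤ (≡-dec ℕ._≟_ ℕ._≟_) image-unique image⊆L ⟩
    length L                ∎
    where
      open ≤-Reasoning
      g² : Fin k × Fin k → ℕ × ℕ
      g² (a , b) = g a , g b

      image-unique : Unique (map g² edges)
      image-unique = Unique.map⁺ (λ e → let (ea , eb) = ,-injective e in cong₂ _,_ (g-inj _ _ ea) (g-inj _ _ eb)) edges-unique

      image⊆L : map g² edges ⊆ L
      image⊆L x∈image with ∈-map⁻ g² x∈image
      ... | (a , b) , ab∈edges , refl = G⊆L (g-adj a b (∈-edges⁻ ab∈edges))

-- The lower-bound instance

module Construction {k} (H : SimpleGraph k) {v w : Fin k} (vw : adj H v w ≡ true) where

  -- Node a of H has ID toℕ a; G₀ is H with w deleted.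
  EdgeAvoiding-w : ℕ → ℕ → Set
  EdgeAvoiding-w x y = ∃₂ λ a b → toℕ a ≡ x × toℕ b ≡ y × a ≢ w × b ≢ w × adj H a b ≡ true

  edgeAvoiding-w? : ∀ x y → Dec (EdgeAvoiding-w x y)
  edgeAvoiding-w? x y = Fin.any? λ a → Fin.any? λ b →
    (toℕ a ℕ.≟ x) ×-dec (toℕ b ℕ.≟ y) ×-dec ¬? (a Fin.≟ w) ×-dec ¬? (b Fin.≟ w) ×-dec (adj H a b Bool.≟ true)

  G₀ : Graph
  G₀ = record
    { V    = map toℕ (filter (λ a → ¬? (a Fin.≟ w)) (allFin k))
    ; nadj = λ x y → does (edgeAvoiding-w? x y) }

  ∈-G₀⁺ : ∀ {a} → a ≢ w → toℕ a ∈ V G₀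
  ∈-G₀⁺ a≢w = ∈-map⁺ toℕ (∈-filter⁺ (λ a → ¬? (a Fin.≟ w)) (∈-allFin _) a≢w)

  toℕ[w]∉G₀ : toℕ w ∉ V G₀
  toℕ[w]∉G₀ w∈G₀ with ∈-map⁻ toℕ w∈G₀
  ... | a , a∈ , e = proj₂ (∈-filter⁻ (λ a → ¬? (a Fin.≟ w)) {xs = allFin k} a∈) (≡.sym (toℕ-injective e))

  G₀-wellFormed : WellFormed G₀
  G₀-wellFormed = Unique.map⁺ toℕ-injective (Unique.filter⁺ _ (Unique.allFin⁺ k))
                , endpoints
                , (λ x y → does-⇔ (mk⇔ swap swap) (edgeAvoiding-w? x y) (edgeAvoiding-w? y x))
                , (λ x → dec-false (edgeAvoiding-w? x x) loop)
    where
      endpoints : ∀ x y → does (edgeAvoiding-w? x y) ≡ true → x ∈ V G₀ × y ∈ V G₀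
      endpoints x y e with a , b , refl , refl , a≢w , b≢w , _ ← does⇒ (edgeAvoiding-w? x y) e =
        ∈-G₀⁺ a≢w , ∈-G₀⁺ b≢w

      swap : ∀ {x y} → EdgeAvoiding-w x y → EdgeAvoiding-w y x
      swap (a , b , ax , by , a≢w , b≢w , ab) = b , a , by , ax , b≢w , a≢w , ≡.trans (sym H b a) ab

      loop : ∀ {x} → ¬ EdgeAvoiding-w x x
      loop (a , b , ax , bx , _ , _ , ab) = adj⇒≢ H ab (toℕ-injective (≡.trans ax (≡.sym bx)))

  S₁ : List ℕ
  S₁ = map toℕ (filter (λ b → adj H w b Bool.≟ true) (allFin k))

  ≢v? : Decidable (_≢ toℕ v)
  ≢v? x = ¬? (x ℕ.≟ toℕ v)

  S₂ : List ℕ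
  S₂ = filter ≢v? S₁

  ∈-S₁⁺ : ∀ {b} → adj H w b ≡ true → toℕ b ∈ S₁
  ∈-S₁⁺ wb = ∈-map⁺ toℕ (∈-filter⁺ (λ b → adj H w b Bool.≟ true) (∈-allFin _) wb)

  ∈-S₁⁻ : ∀ {x} → x ∈ S₁ → ∃ λ b → toℕ b ≡ x × adj H w b ≡ true
  ∈-S₁⁻ x∈S₁ with b , b∈ , refl ← ∈-map⁻ toℕ x∈S₁ =
    b , refl , proj₂ (∈-filter⁻ (λ b → adj H w b Bool.≟ true) {xs = allFin k} b∈)

  S₂⊆S₁ : S₂ ⊆ S₁
  S₂⊆S₁ = proj₁ ∘ ∈-filter⁻ ≢v?

  S₁⊆G₀ : S₁ ⊆ V G₀
  S₁⊆G₀ x∈S₁ with b , refl , wb ← ∈-S₁⁻ x∈S₁ = ∈-G₀⁺ (adj⇒≢ H wb ∘ ≡.sym)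

  withW : List ℕ → Graph
  withW S = insertNode (toℕ w , S) G₀

  G₁ G₂ : Graph
  G₁ = withW S₁
  G₂ = withW S₂

  ∈-withW : ∀ S a → toℕ a ∈ V (withW S)
  ∈-withW S a with a Fin.≟ w
  ... | yes refl = here refl
  ... | no a≢w   = there (∈-G₀⁺ a≢w)

  withW-adj⁻ : ∀ {S x y} → S ⊆ S₁ → nadj (withW S) x y ≡ true →
    ∃₂ λ a b → toℕ a ≡ x × toℕ b ≡ y × adj H a b ≡ true × (b ≡ w → x ∈ S)
  withW-adj⁻ {S} {x} {y} S⊆S₁ e with to (insertNode-adj⇔ {G₀} {toℕ w} {S} {x} {y}) e
  ... | inj₁ old with a , b , ax , by , _ , b≢w , ab ← does⇒ (edgeAvoiding-w? x y) old =
    a , b , ax , by , ab , λ b≡w → contradiction b≡w b≢w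
  ... | inj₂ (inj₁ (refl , y∈S)) with b , by , wb ← ∈-S₁⁻ (S⊆S₁ y∈S) =
    w , b , refl , by , wb , λ b≡w → contradiction (≡.sym b≡w) (adj⇒≢ H wb)
  ... | inj₂ (inj₂ (refl , x∈S)) with a , ax , wa ← ∈-S₁⁻ (S⊆S₁ x∈S) =
    a , w , ax , refl , ≡.trans (sym H a w) wa , λ _ → x∈S

  toℕ-copy : IsCopy H G₁ toℕ
  toℕ-copy = (λ _ _ → toℕ-injective) , ∈-withW S₁ , adj-preserved
    where
      adj-preserved : ∀ a b → adj H a b ≡ true → nadj G₁ (toℕ a) (toℕ b) ≡ true
      adj-preserved a b ab with a Fin.≟ w | b Fin.≟ w
      ... | yes refl | _        = from (insertNode-adj⇔ {G₀} {S = S₁}) (inj₂ (inj₁ (refl , ∈-S₁⁺ ab)))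
      ... | no _     | yes refl = from (insertNode-adj⇔ {G₀} {S = S₁}) (inj₂ (inj₂ (refl , ∈-S₁⁺ (≡.trans (sym H w a) ab))))
      ... | no a≢w   | no b≢w   =
        from (insertNode-adj⇔ {G₀} {S = S₁}) (inj₁ (dec-true (edgeAvoiding-w? _ _) (a , b , refl , refl , a≢w , b≢w , ab)))

  edgeLabels : List (ℕ × ℕ)
  edgeLabels = map (λ (a , b) → toℕ a , toℕ b) (edges H)

  ≢vw? : Decidable (_≢ (toℕ v , toℕ w))
  ≢vw? p = ¬? (≡-dec ℕ._≟_ ℕ._≟_ p (toℕ v , toℕ w))

  G₂⊆edgeLabels-vw : ∀ {x y} → nadj G₂ x y ≡ true → (x , y) ∈ filter ≢vw? edgeLabels
  G₂⊆edgeLabels-vw e with a , b , refl , refl , ab , b≡w⇒a∈S₂ ← withW-adj⁻ S₂⊆S₁ e =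
    ∈-filter⁺ ≢vw? (∈-map⁺ _ (∈-edges⁺ H ab)) λ ab≡vw →
      let (a≡v , b≡w) = ,-injective ab≡vw
      in proj₂ (∈-filter⁻ ≢v? {xs = S₁} (b≡w⇒a∈S₂ (toℕ-injective b≡w))) a≡v

  no-copy : ∀ g → ¬ IsCopy H G₂ g
  no-copy g copy = ℕ.<⇒≱ fewer-labels (copy⇒edges≤ H copy G₂⊆edgeLabels-vw)
    where
      fewer-labels : length (filter ≢vw? edgeLabels) < length (edges H)
      fewer-labels = ≡.subst (length (filter ≢vw? edgeLabels) <_) (length-map _ (edges H))
        (filter-notAll ≢vw? edgeLabels (Any.map (λ vw≡ vw≢ → vw≢ (≡.sym vw≡)) (∈-map⁺ _ (∈-edges⁺ H vw))))

  sameNeighbours : ∀ {x} → x ≢ toℕ w → x ≢ toℕ v → SameNeighbours G₁ G₂ x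
  sameNeighbours {x} x≢w x≢v = insertNode-adj-cong {G₀} x≢w
    (mk⇔ (λ x∈S₁ → ∈-filter⁺ ≢v? x∈S₁ x≢v) S₂⊆S₁)

  Far : ℕ → Fin k → Set
  Far t a = DistGreater H t a v × DistGreater H t a w

  far⇒sameNeighbours : ∀ {t a} → Far t a → SameNeighbours G₁ G₂ (toℕ a)
  far⇒sameNeighbours (far-v , far-w) =
    sameNeighbours (DistGreater⇒≢ H far-w ∘ toℕ-injective) (DistGreater⇒≢ H far-v ∘ toℕ-injective)

  far⇒sameView : ∀ t a → Far t a → SameView G₁ G₂ t (toℕ a)
  far⇒sameView zero    a _ = tt
  far⇒sameView (suc t) a far@(far-v , far-w) =
    far⇒sameView t a (DistGreater-pred H far-v , DistGreater-pred H far-w) ,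
    far⇒sameNeighbours far ,
    neighbour-view
    where
      neighbour-view : ∀ z → nadj G₁ (toℕ a) z ≡ true → SameView G₁ G₂ t z × SameNeighbours G₁ G₂ z
      neighbour-view z e with a′ , b , a′≡a , refl , a′b , _ ← withW-adj⁻ ⊆-refl e
                         with refl ← toℕ-injective a′≡a =
        let far-b = DistGreater-step H far-v a′b , DistGreater-step H far-w a′b
        in far⇒sameView t b far-b , far⇒sameNeighbours far-b

  withW-valid : ∀ {S} → S ⊆ S₁ → ValidEvents G₀ (insertOnce (toℕ w) S)
  withW-valid S⊆S₁ = insertOnce-valid G₀ (toℕ w) toℕ[w]∉G₀ (S₁⊆G₀ ∘ S⊆S₁)

  module _ {T : ℕ} {u : Fin k} (far : Far T u) where

    same-state : ∀ {Out} (A : Algorithm Out) →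
      state A G₀ (insertOnce (toℕ w) S₁) T (toℕ u) ≡ state A G₀ (insertOnce (toℕ w) S₂) T (toℕ u)
    same-state A = state-local A G₀ (toℕ w) S₁ S₂ T (toℕ u) (far⇒sameView T u far)

    correct-at-u : ∀ {P A} → Solves T P A → ∀ {S} → S ⊆ S₁ →
      Correct P (withW S) (toℕ u) (Algorithm.output A (state A G₀ (insertOnce (toℕ w) S) T (toℕ u)))
    correct-at-u solves {S} S⊆S₁ =
      solves G₀ G₀-wellFormed _ (withW-valid S⊆S₁) (insertOnce-promise G₀ (toℕ w) T S)
             0 _ refl (toℕ u) (∈-withW S u)

    ¬solves-MemList : ¬ Σ (Algorithm (Out (MemList H))) (Solves T (MemList H))
    ¬solves-MemList (A , solves) =
      let correct = correct-at-u {MemList H} {A} solves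
          f , f∈out₁ , _ = proj₂ (correct ⊆-refl) toℕ toℕ-copy (u , refl)
          f∈out₂ = ≡.subst (λ s → f ∈ Algorithm.output A s) (same-state A) f∈out₁
      in no-copy f (proj₁ (proj₁ (correct S₂⊆S₁) f f∈out₂))

    ¬solves-MemDetect : ¬ Σ (Algorithm (Out (MemDetect H))) (Solves T (MemDetect H))
    ¬solves-MemDetect (A , solves) =
      let correct = correct-at-u {MemDetect H} {A} solves
          yes₁ = from (correct ⊆-refl) (toℕ , toℕ-copy , u , refl)
          yes₂ = ≡.subst (λ s → Algorithm.output A s ≡ true) (same-state A) yes₁
          g , g-copy , _ = to (correct S₂⊆S₁) yes₂
      in no-copy g g-copy

theorem2p14 : ∀ {k} (H : SimpleGraph k) → Connected H → 3 ≤ k →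
    ∀ D → IsDiamTilde H D →
    ∀ (T : ℕ) → 1 ≤ T → T < D ∸ 1 →
    ¬ (Σ (Algorithm (Out (MemList H))) (Solves T (MemList H)))
    × ¬ (Σ (Algorithm (Out (MemDetect H))) (Solves T (MemDetect H)))
theorem2p14 H _ _ _ ((u , v , w , vw , dv , dw , dist-v , dist-w , D≡1+dv⊓dw) , _) T _ T<D-1 =
  ¬solves-MemList far , ¬solves-MemDetect far
  where
    open Construction H vw

    T<dv⊓dw : T < dv ⊓ dw
    T<dv⊓dw = ≡.subst (λ d → T < d ∸ 1) D≡1+dv⊓dw T<D-1

    far : Far T u
    far = Dist⇒DistGreater H dist-v (<-≤-trans T<dv⊓dw (ℕ.m⊓n≤m dv dw))
        , Dist⇒DistGreater H dist-w (<-≤-trans T<dv⊓dw (ℕ.m⊓n≤n dv dw))
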